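{- Let $S$ be an atomic system and $A,B$ ecumenical formulas. If $\Vdash^L_S A$, $A$ is $S$-monotonic, and $A\Vdash^G_S B$, then both $\Vdash^L_S B$ and $\Vdash^G_S B$.
   Context: Basic setting. Let $\mathsf{At}$ be a countably infinite set of atomic propositions and $\mathsf{At}_\bot=\mathsf{At}\cup\{\bot\}$. An atomic rule has the form "from premises $p_1,\dots,p_n$ ($n\ge 0$) infer $p$", with $p_j,p\in\mathsf{At}_\bot$, where the derivation of each premise may discharge a set of basic sentences. An atomic system $S$ is a set of atomic rules; $S\subseteq S'$ ($S'$ extends $S$) if $S'$ contains all rules of $S$. $\Delta\vdash_S p$ means there is a natural-deduction derivation using only rules of $S$ with conclusion $p$ and undischarged assumptions in $\Delta$ (so $p\vdash_S p$). $S$ is consistent if $\nvdash_S\bot$. Standing convention: all atomic systems (including all extensions quantified over) are required to be consistent. Ecumenical formulas: $p^i,p^c$ for $p\in\mathsf{At}_\bot$; $(A\wedge B)^x,(A\vee B)^x,(A\to B)^x$ for $x\in\{i,c\}$. $\bot$ denotes $\bot^i$; for $X^c$, $X^i$ is the same construction with outer superscript $i$. Weak validity (by simultaneous recursion): (1) $\Vdash^L_S p^i$ iff $\vdash_S p$ ($p\in\mathsf{At}_\bot$); (2) $\Vdash^L_S p^c$ iff $p\nvdash_S\bot$; (3) for non-atomic $X$, $\Vdash^L_S X^c$ iff $X^i\nVdash^L_S\bot$; (4) $\Vdash^L_S(A\wedge B)^i$ iff $\Vdash^L_S A$ and $\Vdash^L_S B$; (5) $\Vdash^L_S(A\to B)^i$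 iff $A\Vdash^G_S B$; (6) $\Vdash^L_S(A\vee B)^i$ iff for all $S'\supseteq S$ and all $p\in\mathsf{At}_\bot$, if $A\Vdash^L_{S'}p^i$ and $B\Vdash^L_{S'}p^i$ then $\Vdash^L_{S'}p^i$; (7) for nonempty $\Gamma$, $\Gamma\Vdash^L_S A$ iff for all $S'\supseteq S$, if $\Vdash^L_{S'}B$ for all $B\in\Gamma$ then $\Vdash^L_{S'}A$; (8) $\Gamma\Vdash^G_S A$ ($\Gamma$ possibly empty) iff for all $S'\supseteq S$: if $\Vdash^L_{S''}B$ for all $B\in\Gamma$ and all $S''\supseteq S'$, then $\Vdash^L_{S''}A$ for all $S''\supseteq S'$. $A$ is $S$-monotonic if for all $S'\supseteq S$, $\Vdash^L_S A$ implies $\Vdash^L_{S'}A$. -}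

module Defs where

open import Data.Nat using (ℕ)
open import Data.List using (List; []; _∷_; _++_)
open import Data.List.Membership.Propositional using (_∈_)
open import Data.List.Relation.Unary.All using (All)
open import Data.Product using (_×_; proj₁; proj₂)
open import Relation.Nullary using (¬_)
open import Level using (Lift; 0ℓ) renaming (suc to lsuc)

data At⊥ : Set where
  atm : ℕ → At⊥
  bot : At⊥

-- Atomic rules: premises are pairs (Γⱼ , pⱼ) where Γⱼ is the (finite) set
-- of basic sentences discharged in the derivation of pⱼ.

record Rule : Set where
  constructor mkRule
  field
    premises : List (List At⊥ × At⊥)
    concl    : At⊥

data Der (R : Rule → Set) : List At⊥ → At⊥ → Set where
  ass : ∀ {Δ p} → p ∈ Δ → Der R Δ p
  app : ∀ {Δ} (r : Rule) → R r →
        All (λ pr → Der R (proj₁ pr ++ Δ) (proj₂ pr)) (Rule.premises r) →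
        Der R Δ (Rule.concl r)

record Sys : Set₁ where
  field
    rules      : Rule → Set
    consistent : ¬ Der rules [] bot
open Sys public

_⊢[_]_ : List At⊥ → Sys → At⊥ → Set
Δ ⊢[ S ] p = Der (rules S) Δ p

_⊆S_ : Sys → Sys → Set
S ⊆S S' = ∀ r → rules S r → rules S' r

data Tag : Set where
  i c : Tag

data Conn : Set where
  and or imp : Conn

data Formula : Set where
  atom : At⊥ → Tag → Formula
  bin  : Conn → Formula → Formula → Tag → Formula

-- Weak validity.  Clauses (3), (5), (6) use (7)/(8) with singleton
-- contexts; those are unfolded inline for structural recursion.

mutual
  ⊩L : Sys → Formula → Set₁
  ⊩L S (atom p i) = Lift (lsuc 0ℓ) ([] ⊢[ S ] p)
  ⊩L S (atom p c) = Lift (lsuc 0ℓ) (¬ ((p ∷ []) ⊢[ S ] bot))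
  ⊩L S (bin k A B i) = ⊩Li S k A B
  -- (3): X^c iff  X^i ⊮^L_S ⊥^i, with (7) unfolded
  ⊩L S (bin k A B c) =
    ¬ (∀ S' → S ⊆S S' → ⊩Li S' k A B → ⊩L S' (atom bot i))

  ⊩Li : Sys → Conn → Formula → Formula → Set₁
  ⊩Li S and A B = ⊩L S A × ⊩L S B
  -- (5): A ⊩^G_S B, with (8) unfolded
  ⊩Li S imp A B =
    ∀ S' → S ⊆S S' →
      (∀ S'' → S' ⊆S S'' → ⊩L S'' A) →
      (∀ S'' → S' ⊆S S'' → ⊩L S'' B)
  -- (6): with A ⊩^L_{S'} p^i unfolded via (7)
  ⊩Li S or A B =
    ∀ S' → S ⊆S S' → ∀ (p : At⊥) →
      (∀ S'' → S' ⊆S S'' → ⊩L S'' A → ⊩L S'' (atom p i)) →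
      (∀ S'' → S' ⊆S S'' → ⊩L S'' B → ⊩L S'' (atom p i)) →
      ⊩L S' (atom p i)


_⊩L[_]_ : List Formula → Sys → Formula → Set₁
Γ ⊩L[ S ] A = ∀ S' → S ⊆S S' → All (⊩L S') Γ → ⊩L S' A

_⊩G[_]_ : List Formula → Sys → Formula → Set₁
Γ ⊩G[ S ] A =
  ∀ S' → S ⊆S S' →
    (∀ S'' → S' ⊆S S'' → All (⊩L S'') Γ) →
    (∀ S'' → S' ⊆S S'' → ⊩L S'' A)

Monotonic : Sys → Formula → Set₁
Monotonic S A = ∀ S' → S ⊆S S' → ⊩L S A → ⊩L S' A

-- Monotonicity makes A hold in every extension of S, which is exactly the
-- uniform premise that A ⊩G B asks for above any S' ⊇ S; instantiating at
-- S itself gives ⊩L B, and at arbitrary S' gives [] ⊩G B.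
module Submission where

open import Defs
open import Data.List using ([]; _∷_)
open import Data.List.Relation.Unary.All using (All; []; _∷_)
open import Data.Product using (_×_; _,_)

⊆S-refl : ∀ S → S ⊆S S
⊆S-refl S r x = x

⊆S-trans : ∀ S S' S'' → S ⊆S S' → S' ⊆S S'' → S ⊆S S''
⊆S-trans S S' S'' e e' r x = e' r (e r x)

monotonic⇒valid-above : ∀ {A} S S' → ⊩L S A → Monotonic S A → S ⊆S S' →
  ∀ S'' → S' ⊆S S'' → All (⊩L S'') (A ∷ [])
monotonic⇒valid-above S S' a mon e S'' e' = mon S'' (⊆S-trans S S' S'' e e') a ∷ []

lemma6 : (S : Sys) (A B : Formula) →
    ⊩L S A → Monotonic S A → (A ∷ []) ⊩G[ S ] B →
    ⊩L S B × ([] ⊩G[ S ] B)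
lemma6 S A B a mon A⊩B = ⊩B S (⊆S-refl S) S (⊆S-refl S) , λ S' e _ → ⊩B S' e
  where
  ⊩B : ∀ S' → S ⊆S S' → ∀ S'' → S' ⊆S S'' → ⊩L S'' B
  ⊩B S' e = A⊩B S' e (monotonic⇒valid-above S S' a mon e)
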